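{- Let $\mathcal{D}=\{0,1,2\}$. Every integer $N\in\mathbb{Z}$ can be written in the form \[ N=\tfrac{1}{2}\sum_{i=0}^{k}d_i\left(-\tfrac32\right)^i \qquad (k\in\mathbb{N}=\{0,1,2,\dots\},\; d_i\in\mathcal{D}), \] with $d_k\neq 0$ whenever $k\geqslant 1$, and this representation (i.e. $k$ and the digits $d_0,\dots,d_k$) is unique.
   Context: $\mathbb{N}$ denotes the set of nonnegative integers. -}

module Defs where

open import Data.Nat using (ℕ; zero; suc; _≥_)
open import Data.Integer using (ℤ; +_)
open import Data.Fin using (Fin; toℕ)
open import Data.Vec using (Vec; []; _∷_; last)
open import Data.Rational using (ℚ; _/_; _+_; _*_; -_; ½; 0ℚ; 1ℚ)
open import Data.Product using (Σ; _,_; ∃!; _×_)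
open import Relation.Binary.PropositionalEquality using (_≡_; _≢_)

Digit : Set
Digit = Fin 3

digitℚ : Digit → ℚ
digitℚ d = + (toℕ d) / 1

pow : ℚ → ℕ → ℚ
pow q zero    = 1ℚ
pow q (suc n) = q * pow q n

base : ℚ
base = - (+ 3 / 2)

evalFrom : {n : ℕ} → ℕ → Vec Digit n → ℚ
evalFrom i []       = 0ℚ
evalFrom i (d ∷ ds) = digitℚ d * pow base i + evalFrom (suc i) ds

Rep : Set
Rep = Σ ℕ (λ k → Vec Digit (suc k))

value : Rep → ℚ
value (k , ds) = ½ * evalFrom 0 ds

Admissible : Rep → Set
Admissible (k , ds) = k ≥ 1 → last ds ≢ Fin.zero
  where import Data.Fin as Fin

-- Multiplying ½ Σᵢ dᵢ (−3/2)ⁱ by 2ⁿ⁺¹ gives an integer, and comparing these integers shows that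
-- d₀ d₁ … represents N exactly when the tail d₁ … represents an integer M with N = d₀/2 − 3M/2
-- (M is integral because 3 is coprime to 2). Since d₀ = 2N + 3M lies in {0,1,2}, it is
-- 2N mod 3, and then M is determined as well; uniqueness follows by induction on the length.
-- For existence, iterate this division step: it shrinks N until the rest M becomes 0.
module Submission where

open import Defs
open import Data.Integer using (ℤ)
open import Data.Rational using (_/_)
open import Data.Product using (∃!; _×_)
open import Relation.Binary.PropositionalEquality using (_≡_)

open import Data.Nat.Base as ℕ using (ℕ; zero; suc; z≤n; s≤s)
import Data.Nat.Properties as ℕ
open import Data.Nat.Coprimality using (coprime?)
open import Data.Nat.DivMod using (_divMod_; result)
import Data.Nat.Divisibility as ℕ
open import Data.Nat.Induction using (<-wellFounded)
open import Data.Integer.Base using (+_; -[1+_]; 0ℤ; _+_; _-_; _*_; -_; _^_; ∣_∣)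
import Data.Integer.Properties as ℤ
open import Data.Integer.Divisibility using (_∣_)
import Data.Integer.Divisibility.Signed as Signed
open import Data.Integer.Coprimality using (Coprime; coprime-divisor)
open import Data.Integer.Tactic.RingSolver using (solve-∀)
open import Data.Rational as ℚ using (ℚ; ½; 1ℚ)
import Data.Rational.Properties as ℚ
import Data.Rational.Unnormalised as ℚᵘ
import Data.Rational.Unnormalised.Properties as ℚᵘ
open import Data.Rational.Solver using (module +-*-Solver)
open import Data.Fin.Base using (toℕ) renaming (zero to 0F)
open import Data.Fin.Properties using (all?; _≟_)
open import Data.Vec.Base using (Vec; []; _∷_; last)
open import Data.Product using (Σ; ∃; ∃₂; _,_; proj₁)
open import Induction.WellFounded using (Acc; acc)
open import Relation.Nullary using (yes; no; contradiction)
open import Relation.Nullary.Decidable using (from-yes; _→-dec_)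
open import Relation.Binary.PropositionalEquality
  using (_≢_; refl; sym; trans; cong; cong₂; subst; module ≡-Reasoning)

fromℤ : ℤ → ℚ
fromℤ i = i / 1

toℚᵘ-fromℤ : ∀ i → ℚ.toℚᵘ (fromℤ i) ℚᵘ.≃ ℚᵘ.mkℚᵘ i 0
toℚᵘ-fromℤ i = ℚ.toℚᵘ-fromℚᵘ (ℚᵘ.mkℚᵘ i 0)

fromℤ-+ : ∀ i j → fromℤ (i + j) ≡ fromℤ i ℚ.+ fromℤ j
fromℤ-+ i j = ℚ.toℚᵘ-injective (begin
  ℚ.toℚᵘ (fromℤ (i + j))                  ≈⟨ toℚᵘ-fromℤ (i + j) ⟩
  ℚᵘ.mkℚᵘ (i + j) 0                       ≈⟨ ℚᵘ.*≡* (cong (_* + 1) (sym (cong₂ _+_ (ℤ.*-identityʳ i) (ℤ.*-identityʳ j)))) ⟩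
  ℚᵘ.mkℚᵘ i 0 ℚᵘ.+ ℚᵘ.mkℚᵘ j 0            ≈⟨ ℚᵘ.+-cong (toℚᵘ-fromℤ i) (toℚᵘ-fromℤ j) ⟨
  ℚ.toℚᵘ (fromℤ i) ℚᵘ.+ ℚ.toℚᵘ (fromℤ j)  ≈⟨ ℚ.toℚᵘ-homo-+ (fromℤ i) (fromℤ j) ⟨
  ℚ.toℚᵘ (fromℤ i ℚ.+ fromℤ j)            ∎)
  where open ℚᵘ.≃-Reasoning

fromℤ-* : ∀ i j → fromℤ (i * j) ≡ fromℤ i ℚ.* fromℤ j
fromℤ-* i j = ℚ.toℚᵘ-injective (begin
  ℚ.toℚᵘ (fromℤ (i * j))                  ≈⟨ toℚᵘ-fromℤ (i * j) ⟩
  ℚᵘ.mkℚᵘ (i * j) 0                       ≈⟨ ℚᵘ.*≡* refl ⟩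
  ℚᵘ.mkℚᵘ i 0 ℚᵘ.* ℚᵘ.mkℚᵘ j 0            ≈⟨ ℚᵘ.*-cong (toℚᵘ-fromℤ i) (toℚᵘ-fromℤ j) ⟨
  ℚ.toℚᵘ (fromℤ i) ℚᵘ.* ℚ.toℚᵘ (fromℤ j)  ≈⟨ ℚ.toℚᵘ-homo-* (fromℤ i) (fromℤ j) ⟨
  ℚ.toℚᵘ (fromℤ i ℚ.* fromℤ j)            ∎)
  where open ℚᵘ.≃-Reasoning

fromℤ-injective : ∀ {i j} → fromℤ i ≡ fromℤ j → i ≡ j
fromℤ-injective {i} {j} eq
  with ℚᵘ.≃-trans (ℚᵘ.≃-sym (toℚᵘ-fromℤ i)) (ℚᵘ.≃-trans (ℚ.toℚᵘ-cong eq) (toℚᵘ-fromℤ j))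
... | ℚᵘ.*≡* i*1≡j*1 = trans (sym (ℤ.*-identityʳ i)) (trans i*1≡j*1 (ℤ.*-identityʳ j))

fromℤ-^ : ∀ i n → fromℤ (i ^ n) ≡ pow (fromℤ i) n
fromℤ-^ i zero    = refl
fromℤ-^ i (suc n) = trans (fromℤ-* i (i ^ n)) (cong (fromℤ i ℚ.*_) (fromℤ-^ i n))

pow-inverse : ∀ {a b} n → a ℚ.* b ≡ 1ℚ → pow a n ℚ.* pow b n ≡ 1ℚ
pow-inverse zero    ab≡1 = refl
pow-inverse {a} {b} (suc n) ab≡1 = begin
  (a ℚ.* pow a n) ℚ.* (b ℚ.* pow b n)   ≡⟨ solve 4 (λ a b x y → (a :* x) :* (b :* y) := (a :* b) :* (x :* y))
                                               refl a b (pow a n) (pow b n) ⟩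
  (a ℚ.* b) ℚ.* (pow a n ℚ.* pow b n)   ≡⟨ cong₂ ℚ._*_ ab≡1 (pow-inverse n ab≡1) ⟩
  1ℚ ℚ.* 1ℚ                             ≡⟨⟩
  1ℚ                                    ∎
  where open ≡-Reasoning
        open +-*-Solver

*-cancelˡ-invertible : ∀ {a b p q} → a ℚ.* b ≡ 1ℚ → b ℚ.* p ≡ b ℚ.* q → p ≡ q
*-cancelˡ-invertible {a} {b} {p} {q} ab≡1 bp≡bq = begin
  p                   ≡⟨ ℚ.*-identityˡ p ⟨
  1ℚ ℚ.* p            ≡⟨ cong (ℚ._* p) ab≡1 ⟨
  (a ℚ.* b) ℚ.* p     ≡⟨ ℚ.*-assoc a b p ⟩
  a ℚ.* (b ℚ.* p)     ≡⟨ cong (a ℚ.*_) bp≡bq ⟩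
  a ℚ.* (b ℚ.* q)     ≡⟨ ℚ.*-assoc a b q ⟨
  (a ℚ.* b) ℚ.* q     ≡⟨ cong (ℚ._* q) ab≡1 ⟩
  1ℚ ℚ.* q            ≡⟨ ℚ.*-identityˡ q ⟩
  q                   ∎
  where open ≡-Reasoning

*-cancelˡ-2^ : ∀ n {p q} → fromℤ ((+ 2) ^ n) ℚ.* p ≡ fromℤ ((+ 2) ^ n) ℚ.* q → p ≡ q
*-cancelˡ-2^ n = *-cancelˡ-invertible {pow ½ n}
  (trans (cong (pow ½ n ℚ.*_) (fromℤ-^ (+ 2) n)) (pow-inverse n refl))

evalFrom-suc : ∀ {n} i (ds : Vec Digit n) → evalFrom (suc i) ds ≡ base ℚ.* evalFrom i ds
evalFrom-suc i []       = refl
evalFrom-suc i (d ∷ ds) = begin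
  digitℚ d ℚ.* (base ℚ.* pow base i) ℚ.+ evalFrom (suc (suc i)) ds
    ≡⟨ cong (digitℚ d ℚ.* (base ℚ.* pow base i) ℚ.+_) (evalFrom-suc (suc i) ds) ⟩
  digitℚ d ℚ.* (base ℚ.* pow base i) ℚ.+ base ℚ.* evalFrom (suc i) ds
    ≡⟨ solve 4 (λ x b p e → x :* (b :* p) :+ b :* e := b :* (x :* p :+ e))
         refl (digitℚ d) base (pow base i) (evalFrom (suc i) ds) ⟩
  base ℚ.* (digitℚ d ℚ.* pow base i ℚ.+ evalFrom (suc i) ds) ∎
  where open ≡-Reasoning
        open +-*-Solver

digitℤ : Digit → ℤ
digitℤ d = + toℕ d

-- 2ⁿ · ½ Σᵢ dᵢ (−3/2)ⁱ = Σᵢ dᵢ (−3)ⁱ 2ⁿ⁻¹⁻ⁱ, an integer.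
scaled : ∀ {n} → Vec Digit n → ℤ
scaled []               = 0ℤ
scaled {suc n} (d ∷ ds) = (+ 2) ^ n * digitℤ d - + 3 * scaled ds

fromℤ-scaled : ∀ {n} (ds : Vec Digit n) → fromℤ ((+ 2) ^ n) ℚ.* (½ ℚ.* evalFrom 0 ds) ≡ fromℤ (scaled ds)
fromℤ-scaled []               = refl
fromℤ-scaled {suc n} (d ∷ ds) = begin
  fromℤ ((+ 2) ^ suc n) ℚ.* (½ ℚ.* (x ℚ.* 1ℚ ℚ.+ evalFrom 1 ds))
    ≡⟨ cong₂ (λ c e → c ℚ.* (½ ℚ.* (x ℚ.* 1ℚ ℚ.+ e))) (fromℤ-* (+ 2) ((+ 2) ^ n)) (evalFrom-suc 0 ds) ⟩
  (fromℤ (+ 2) ℚ.* c) ℚ.* (½ ℚ.* (x ℚ.* 1ℚ ℚ.+ base ℚ.* e))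
    ≡⟨ solve 3 (λ c x e → (con (fromℤ (+ 2)) :* c) :* (con ½ :* (x :* con 1ℚ :+ con base :* e))
                            := c :* x :+ con (fromℤ (- + 3)) :* (c :* (con ½ :* e)))
         refl c x e ⟩
  c ℚ.* x ℚ.+ fromℤ (- + 3) ℚ.* (c ℚ.* (½ ℚ.* e))
    ≡⟨ cong (λ s → c ℚ.* x ℚ.+ fromℤ (- + 3) ℚ.* s) (fromℤ-scaled ds) ⟩
  fromℤ ((+ 2) ^ n) ℚ.* fromℤ (digitℤ d) ℚ.+ fromℤ (- + 3) ℚ.* fromℤ (scaled ds)
    ≡⟨ cong₂ ℚ._+_ (fromℤ-* ((+ 2) ^ n) (digitℤ d)) (fromℤ-* (- + 3) (scaled ds)) ⟨
  fromℤ ((+ 2) ^ n * digitℤ d) ℚ.+ fromℤ (- + 3 * scaled ds)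
    ≡⟨ fromℤ-+ ((+ 2) ^ n * digitℤ d) (- + 3 * scaled ds) ⟨
  fromℤ ((+ 2) ^ n * digitℤ d + - + 3 * scaled ds)
    ≡⟨ cong (λ t → fromℤ ((+ 2) ^ n * digitℤ d + t)) (ℤ.neg-distribˡ-* (+ 3) (scaled ds)) ⟨
  fromℤ (scaled (d ∷ ds)) ∎
  where
  open ≡-Reasoning
  open +-*-Solver
  c = fromℤ ((+ 2) ^ n)
  x = digitℚ d
  e = evalFrom 0 ds

-- N = d/2 + (−3/2)·M: the digit d followed by a representation of M represents N.
record Splits (N : ℤ) (d : Digit) (M : ℤ) : Set where
  constructor splits
  field digit-eq : digitℤ d ≡ + 2 * N + + 3 * M

0-splits : Splits 0ℤ 0F 0ℤ
0-splits = splits refl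

data _represents_ : ∀ {n} → Vec Digit n → ℤ → Set where
  []   : [] represents 0ℤ
  cons : ∀ {n d M N} {ds : Vec Digit n} → Splits N d M → ds represents M → (d ∷ ds) represents N

i∣i*j : ∀ i j → i ∣ i * j
i∣i*j i j = Signed.∣⇒∣ᵤ (Signed.∣m⇒∣m*n {i} {i} j Signed.∣-refl)

coprime-^-divisor : ∀ i j n k → Coprime i j → i ∣ j ^ n * k → i ∣ k
coprime-^-divisor i j zero    k _   i∣1*k     = subst (i ∣_) (ℤ.*-identityˡ k) i∣1*k
coprime-^-divisor i j (suc n) k i⊥j i∣j^1+n*k = coprime-^-divisor i j n k i⊥j
  (coprime-divisor i j (j ^ n * k) i⊥j (subst (i ∣_) (ℤ.*-assoc j (j ^ n) k) i∣j^1+n*k))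

coprime-3-2 : Coprime (+ 3) (+ 2)
coprime-3-2 = from-yes (coprime? 3 2)

digitℤ-injective-mod-3 : ∀ d d' → + 3 ∣ digitℤ d - digitℤ d' → d ≡ d'
digitℤ-injective-mod-3 = from-yes (all? λ d → all? λ d' →
  (3 ℕ.∣? ∣ digitℤ d - digitℤ d' ∣) →-dec (d ≟ d'))

splits-unique : ∀ {N d d' M M'} → Splits N d M → Splits N d' M' → d ≡ d' × M ≡ M'
splits-unique {N} {d} {d'} {M} {M'} (splits eq) (splits eq') = d≡d' , M≡M'
  where
  difference : ∀ a b c → (a + + 3 * b) - (a + + 3 * c) ≡ + 3 * (b - c)
  difference = solve-∀
  d≡d' : d ≡ d'
  d≡d' = digitℤ-injective-mod-3 d d' (subst (+ 3 ∣_)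
    (sym (trans (cong₂ _-_ eq eq') (difference (+ 2 * N) M M'))) (i∣i*j (+ 3) (M - M')))
  M≡M' : M ≡ M'
  M≡M' = ℤ.*-cancelˡ-≡ (+ 3) M M'
    (+-Group.∙-cancelˡ (+ 2 * N) _ _ (trans (sym eq) (trans (cong digitℤ d≡d') eq')))
    where import Algebra.Properties.AbelianGroup ℤ.+-0-abelianGroup as +-Group

represents⇒scaled : ∀ {n N} {ds : Vec Digit n} → ds represents N → scaled ds ≡ (+ 2) ^ n * N
represents⇒scaled [] = refl
represents⇒scaled {suc n} {N} {d ∷ ds} (cons {M = M} (splits eq) r) = begin
  p * digitℤ d - + 3 * scaled ds           ≡⟨ cong₂ (λ x s → p * x - + 3 * s) eq (represents⇒scaled r) ⟩
  p * (+ 2 * N + + 3 * M) - + 3 * (p * M)  ≡⟨ expand p N M ⟩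
  (+ 2 * p) * N                            ∎
  where
  open ≡-Reasoning
  p = (+ 2) ^ n
  expand : ∀ p N M → p * (+ 2 * N + + 3 * M) - + 3 * (p * M) ≡ (+ 2 * p) * N
  expand = solve-∀

scaled-cons : ∀ {n N} d (ds : Vec Digit n) → scaled (d ∷ ds) ≡ (+ 2) ^ suc n * N →
              (+ 2) ^ n * (digitℤ d - + 2 * N) ≡ + 3 * scaled ds
scaled-cons {n} {N} d ds eq = begin
  p * (x - + 2 * N)          ≡⟨ distrib p x N ⟩
  p * x - (+ 2 * p) * N      ≡⟨ cong (λ t → p * x - t) eq ⟨
  p * x - (p * x - + 3 * s)  ≡⟨ cancel (p * x) s ⟩
  + 3 * s                    ∎
  where
  open ≡-Reasoning
  p = (+ 2) ^ n
  s = scaled ds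
  x = digitℤ d
  distrib : ∀ p x N → p * (x - + 2 * N) ≡ p * x - (+ 2 * p) * N
  distrib = solve-∀
  cancel : ∀ a s → a - (a - + 3 * s) ≡ + 3 * s
  cancel = solve-∀

-- 3 divides 2ⁿ(d − 2N), hence d − 2N, as 3 is coprime to 2.
scaled-tail : ∀ {n N} d (ds : Vec Digit n) → scaled (d ∷ ds) ≡ (+ 2) ^ suc n * N →
              ∃ λ M → Splits N d M × scaled ds ≡ (+ 2) ^ n * M
scaled-tail {n} {N} d ds eq
  with Signed.∣ᵤ⇒∣ (coprime-^-divisor (+ 3) (+ 2) n (digitℤ d - + 2 * N) coprime-3-2
         (subst (+ 3 ∣_) (sym (scaled-cons d ds eq)) (i∣i*j (+ 3) (scaled ds))))
... | Signed.divides M x-2N≡M*3 = M , splits digit-eq , ℤ.*-cancelˡ-≡ (+ 3) (scaled ds) (p * M) 3s≡3pM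
  where
  open ≡-Reasoning
  p = (+ 2) ^ n
  x = digitℤ d
  regroup : ∀ x y → x ≡ y + (x - y)
  regroup = solve-∀
  rotate : ∀ p M → p * (M * + 3) ≡ + 3 * (p * M)
  rotate = solve-∀

  digit-eq : x ≡ + 2 * N + + 3 * M
  digit-eq = begin
    x                        ≡⟨ regroup x (+ 2 * N) ⟩
    + 2 * N + (x - + 2 * N)  ≡⟨ cong (λ t → + 2 * N + t) (trans x-2N≡M*3 (ℤ.*-comm M (+ 3))) ⟩
    + 2 * N + + 3 * M        ∎

  3s≡3pM : + 3 * scaled ds ≡ + 3 * (p * M)
  3s≡3pM = begin
    + 3 * scaled ds    ≡⟨ scaled-cons d ds eq ⟨
    p * (x - + 2 * N)  ≡⟨ cong (p *_) x-2N≡M*3 ⟩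
    p * (M * + 3)      ≡⟨ rotate p M ⟩
    + 3 * (p * M)      ∎

scaled⇒represents : ∀ {n N} (ds : Vec Digit n) → scaled ds ≡ (+ 2) ^ n * N → ds represents N
scaled⇒represents {N = N} [] eq = subst ([] represents_) (trans eq (ℤ.*-identityˡ N)) []
scaled⇒represents (d ∷ ds) eq =
  let _ , s , eq′ = scaled-tail d ds eq in cons s (scaled⇒represents ds eq′)

represents⇒value : ∀ {n N} {ds : Vec Digit n} → ds represents N → ½ ℚ.* evalFrom 0 ds ≡ fromℤ N
represents⇒value {n} {N} {ds} r = *-cancelˡ-2^ n (begin
  fromℤ ((+ 2) ^ n) ℚ.* (½ ℚ.* evalFrom 0 ds)  ≡⟨ fromℤ-scaled ds ⟩
  fromℤ (scaled ds)                            ≡⟨ cong fromℤ (represents⇒scaled r) ⟩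
  fromℤ ((+ 2) ^ n * N)                        ≡⟨ fromℤ-* ((+ 2) ^ n) N ⟩
  fromℤ ((+ 2) ^ n) ℚ.* fromℤ N                ∎)
  where open ≡-Reasoning

value⇒represents : ∀ {n N} {ds : Vec Digit n} → ½ ℚ.* evalFrom 0 ds ≡ fromℤ N → ds represents N
value⇒represents {n} {N} {ds} eq = scaled⇒represents ds (fromℤ-injective (begin
  fromℤ (scaled ds)                            ≡⟨ fromℤ-scaled ds ⟨
  fromℤ ((+ 2) ^ n) ℚ.* (½ ℚ.* evalFrom 0 ds)  ≡⟨ cong (fromℤ ((+ 2) ^ n) ℚ.*_) eq ⟩
  fromℤ ((+ 2) ^ n) ℚ.* fromℤ N                ≡⟨ fromℤ-* ((+ 2) ^ n) N ⟨
  fromℤ ((+ 2) ^ n * N)                        ∎))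
  where open ≡-Reasoning

-- Twice |N|, plus one for negative N: a digit step sends N to about −2N/3, and the
-- extra weight of negative numbers makes the step −1 ↦ 1 decrease too.
size : ℤ → ℕ
size (+ n)    = 2 ℕ.* n
size -[1+ n ] = suc (2 ℕ.* suc n)

size-neg : ∀ n → size (- + n) ℕ.≤ suc (2 ℕ.* n)
size-neg zero    = z≤n
size-neg (suc n) = ℕ.≤-refl

pos-+-* : ∀ a b c → + (a ℕ.+ b ℕ.* c) ≡ + a + + b * + c
pos-+-* a b c = trans (ℤ.pos-+ a (b ℕ.* c)) (cong (λ t → + a + t) (ℤ.pos-* b c))

splits-smaller : ∀ N → N ≢ 0ℤ → ∃₂ λ d M → Splits N d M × size M ℕ.< size N
splits-smaller (+ zero)  N≢0 = contradiction refl N≢0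
splits-smaller (+ suc n) _ with 2 ℕ.* suc n divMod 3
... | result q r 2[1+n]≡r+q*3 = r , - + q , splits digit-eq , smaller
  where
  regroup : ∀ r q → r ≡ (r + q * + 3) + + 3 * - q
  regroup = solve-∀

  digit-eq : digitℤ r ≡ + 2 * + suc n + + 3 * - + q
  digit-eq = begin
    digitℤ r                              ≡⟨ regroup (digitℤ r) (+ q) ⟩
    (digitℤ r + + q * + 3) + + 3 * - + q  ≡⟨ cong (_+ + 3 * - + q) (pos-+-* (toℕ r) q 3) ⟨
    + (toℕ r ℕ.+ q ℕ.* 3) + + 3 * - + q   ≡⟨ cong (λ t → + t + + 3 * - + q) 2[1+n]≡r+q*3 ⟨
    + (2 ℕ.* suc n) + + 3 * - + q         ≡⟨ cong (_+ + 3 * - + q) (ℤ.pos-* 2 (suc n)) ⟩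
    + 2 * + suc n + + 3 * - + q           ∎
    where open ≡-Reasoning

  q≤n : q ℕ.≤ n
  q≤n = ℕ.≤-pred (ℕ.*-cancelʳ-< 3 q (suc n) (begin-strict
    q ℕ.* 3                ≤⟨ ℕ.m≤n+m (q ℕ.* 3) (toℕ r) ⟩
    toℕ r ℕ.+ q ℕ.* 3      ≡⟨ 2[1+n]≡r+q*3 ⟨
    2 ℕ.* suc n            <⟨ ℕ.*-monoˡ-< (suc n) (ℕ.n<1+n 2) ⟩
    3 ℕ.* suc n            ≡⟨ ℕ.*-comm 3 (suc n) ⟩
    suc n ℕ.* 3            ∎))
    where open ℕ.≤-Reasoning

  smaller : size (- + q) ℕ.< size (+ suc n)
  smaller = begin-strict
    size (- + q)     ≤⟨ size-neg q ⟩
    suc (2 ℕ.* q)    ≤⟨ s≤s (ℕ.*-monoʳ-≤ 2 q≤n) ⟩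
    suc (2 ℕ.* n)    <⟨ ℕ.n<1+n _ ⟩
    2 ℕ.+ 2 ℕ.* n    ≡⟨ ℕ.*-suc 2 n ⟨
    2 ℕ.* suc n      ∎
    where open ℕ.≤-Reasoning
splits-smaller -[1+ n ] _ with suc n divMod 3
... | result q r 1+n≡r+q*3 = r , + (toℕ r ℕ.+ q ℕ.* 2) , splits digit-eq , smaller
  where
  regroup : ∀ r q → r ≡ + 2 * - (r + q * + 3) + + 3 * (r + q * + 2)
  regroup = solve-∀

  digit-eq : digitℤ r ≡ + 2 * -[1+ n ] + + 3 * + (toℕ r ℕ.+ q ℕ.* 2)
  digit-eq = begin
    digitℤ r
      ≡⟨ regroup (digitℤ r) (+ q) ⟩
    + 2 * - (digitℤ r + + q * + 3) + + 3 * (digitℤ r + + q * + 2)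
      ≡⟨ cong₂ (λ a b → + 2 * - a + + 3 * b) (trans (cong +_ 1+n≡r+q*3) (pos-+-* (toℕ r) q 3)) (pos-+-* (toℕ r) q 2) ⟨
    + 2 * -[1+ n ] + + 3 * + (toℕ r ℕ.+ q ℕ.* 2)
      ∎
    where open ≡-Reasoning

  smaller : size (+ (toℕ r ℕ.+ q ℕ.* 2)) ℕ.< size -[1+ n ]
  smaller = s≤s (ℕ.*-monoʳ-≤ 2 (begin
    toℕ r ℕ.+ q ℕ.* 2  ≤⟨ ℕ.+-monoʳ-≤ (toℕ r) (ℕ.*-monoʳ-≤ q (ℕ.n≤1+n 2)) ⟩
    toℕ r ℕ.+ q ℕ.* 3  ≡⟨ 1+n≡r+q*3 ⟨
    suc n              ∎))
    where open ℕ.≤-Reasoning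

nonzero-representation : ∀ N → N ≢ 0ℤ → Acc ℕ._<_ (size N) →
                         ∃ λ k → Σ (Vec Digit (suc k)) λ ds → ds represents N × last ds ≢ 0F
nonzero-representation N N≢0 (acc rec) with splits-smaller N N≢0
... | d , M , s , M<N with M ℤ.≟ 0ℤ
...   | yes refl = 0 , d ∷ [] , cons s [] , d≢0
  where
  d≢0 : d ≢ 0F
  d≢0 refl = N≢0 (ℤ.*-cancelˡ-≡ (+ 2) N 0ℤ
    (trans (sym (ℤ.+-identityʳ (+ 2 * N))) (sym (Splits.digit-eq s))))
...   | no M≢0   = let k , ds , r , last≢0 = nonzero-representation M M≢0 (rec M<N)
                   in suc k , d ∷ ds , cons s r , last≢0

representation : ∀ N → ∃ λ k → Σ (Vec Digit (suc k)) λ ds → Admissible (k , ds) × ds represents N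
representation N with N ℤ.≟ 0ℤ
... | yes refl = 0 , 0F ∷ [] , (λ ()) , cons 0-splits []
... | no N≢0   = let k , ds , r , last≢0 = nonzero-representation N N≢0 (<-wellFounded (size N))
                 in k , ds , (λ _ → last≢0) , r

represents-0⇒last≡0 : ∀ {k} {ds : Vec Digit (suc k)} → ds represents 0ℤ → last ds ≡ 0F
represents-0⇒last≡0 {zero}  (cons s []) = proj₁ (splits-unique s 0-splits)
represents-0⇒last≡0 {suc k} (cons s r) with splits-unique s 0-splits
... | _ , refl = represents-0⇒last≡0 r

representation-unique : ∀ {k k' N} {ds : Vec Digit (suc k)} {ds' : Vec Digit (suc k')} →
                        Admissible (k , ds) → Admissible (k' , ds') →
                        ds represents N → ds' represents N → (k , ds) ≡ (k' , ds')
representation-unique {zero} {zero} _ _ (cons s []) (cons s' []) with splits-unique s s'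
... | refl , _ = refl
representation-unique {zero} {suc _} _ adm' (cons s []) (cons s' r') with splits-unique s s'
... | refl , refl = contradiction (represents-0⇒last≡0 r') (adm' (s≤s z≤n))
representation-unique {suc _} {zero} adm _ (cons s r) (cons s' []) with splits-unique s s'
... | refl , refl = contradiction (represents-0⇒last≡0 r) (adm (s≤s z≤n))
representation-unique {suc _} {suc _} adm adm' (cons s r) (cons s' r') with splits-unique s s'
... | refl , refl with representation-unique (λ _ → adm (s≤s z≤n)) (λ _ → adm' (s≤s z≤n)) r r'
...   | refl = refl

proposition1 : (N : ℤ) → ∃! _≡_ (λ (r : Rep) → Admissible r × value r ≡ N / 1)
proposition1 N =
  let k , ds , adm , r = representation N
  in (k , ds) , (adm , represents⇒value r) ,
     λ { {k' , ds'} (adm' , v') → representation-unique adm adm' r (value⇒represents v') }
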